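{- Every proper max-point-tolerance graph is asteroidal triple free.
   Context: A graph $G=(V,E)$ (finite, simple, undirected) is a max-point-tolerance graph (MPTG) if each vertex $u$ can be assigned a pair $(I_u,p_u)$, with $I_u$ a closed bounded real interval and $p_u\in I_u$, such that for distinct $u,v$, $uv\in E$ iff $\{p_u,p_v\}\subseteq I_u\cap I_v$. It is a proper MPTG if it has such a representation in which no interval properly contains another. An asteroidal triple is an independent set of three vertices such that each pair of them is joined by a path avoiding the closed neighbourhood (the vertex and all its neighbours) of the third; a graph is asteroidal triple free if it has no asteroidal triple.
   Formalization: The intervals $I_u$ have rational endpoints and the points $p_u$ are rational, instead of real, in the proper max-point-tolerance representations. -}

module Defs where

open import Level using (0ℓ)
open import Data.Nat using (ℕ)
open import Data.Fin using (Fin)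
open import Data.Rational using (ℚ; _≤_)
open import Data.Product using (_×_; Σ)
open import Relation.Binary.PropositionalEquality using (_≡_; _≢_)
open import Relation.Nullary using (¬_)
open import Function.Bundles using (_⇔_)

record Graph : Set₁ where
  field
    n       : ℕ
    Adj     : Fin n → Fin n → Set
    sym     : ∀ {u v} → Adj u v → Adj v u
    irrefl  : ∀ {u} → ¬ Adj u u

open Graph public

record IntervalPoint : Set where
  constructor ip
  field
    lo    : ℚ
    hi    : ℚ
    pt    : ℚ
    lo≤pt : lo ≤ pt
    pt≤hi : pt ≤ hi

open IntervalPoint public

_∈I_ : ℚ → IntervalPoint → Set
x ∈I a = (lo a ≤ x) × (x ≤ hi a)

BothPointsInBoth : IntervalPoint → IntervalPoint → Set
BothPointsInBoth a b =
  (pt a ∈I a) × (pt a ∈I b) × (pt b ∈I a) × (pt b ∈I b)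

_⊆I_ : IntervalPoint → IntervalPoint → Set
a ⊆I b = (lo b ≤ lo a) × (hi a ≤ hi b)

_⊂I_ : IntervalPoint → IntervalPoint → Set
a ⊂I b = (a ⊆I b) × ¬ ((lo a ≡ lo b) × (hi a ≡ hi b))

IsMPTRep : (G : Graph) → (Fin (n G) → IntervalPoint) → Set
IsMPTRep G r = ∀ u v → u ≢ v → (Adj G u v ⇔ BothPointsInBoth (r u) (r v))

IsProperRep : (G : Graph) → (Fin (n G) → IntervalPoint) → Set
IsProperRep G r = ∀ u v → ¬ (r u ⊂I r v)

IsProperMPTG : Graph → Set
IsProperMPTG G =
  Σ (Fin (n G) → IntervalPoint) λ r → IsMPTRep G r × IsProperRep G r

OutsideN[_] : (G : Graph) → Fin (n G) → Fin (n G) → Set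
OutsideN[ G ] z w = (w ≢ z) × ¬ Adj G w z

data PathAvoiding (G : Graph) (z : Fin (n G)) : Fin (n G) → Fin (n G) → Set where
  here : ∀ {x} → OutsideN[ G ] z x → PathAvoiding G z x x
  step : ∀ {x w y} → OutsideN[ G ] z x → Adj G x w →
         PathAvoiding G z w y → PathAvoiding G z x y

IsAsteroidalTriple : (G : Graph) → Fin (n G) → Fin (n G) → Fin (n G) → Set
IsAsteroidalTriple G a b c =
  (a ≢ b) × (b ≢ c) × (a ≢ c) ×
  ¬ Adj G a b × ¬ Adj G b c × ¬ Adj G a c ×
  PathAvoiding G c a b × PathAvoiding G a b c × PathAvoiding G b a c

IsATFree : Graph → Set
IsATFree G = ∀ a b c → ¬ IsAsteroidalTriple G a b c

{-# OPTIONS --safe #-}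
module Submission where

-- Order the vertices of an asteroidal triple by their points; say p_a ≤ p_b ≤ p_c.
-- The path from a to c avoiding N[b] must cross p_b: a vertex with point p_b
-- would be adjacent to b, so some edge xy of the path has p_x < p_b < p_y.
-- Then p_b ∈ I_x ∩ I_y, and as neither x nor y is adjacent to b, p_x and p_y
-- lie outside I_b, on either side of it; hence I_b ⊂ I_x, so the representation
-- is not proper.

open import Defs
open import Data.Fin using (Fin)
open import Data.Product using (_×_; _,_)
open import Data.Sum using (_⊎_; inj₁; inj₂; [_,_]′)
open import Data.Rational using (ℚ; _≤_; _<_)
open import Data.Rational.Properties
  using (≤-trans; ≤-total; ≤-antisym; ≰⇒>; <⇒≤; <⇒≢; ≤-<-trans)
open import Relation.Binary.PropositionalEquality as ≡ using (_≡_; subst)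
open import Relation.Nullary using (¬_)
open import Function.Bundles using (Equivalence)

Between : ℚ → ℚ → ℚ → Set
Between p q r = (p ≤ q × q ≤ r) ⊎ (r ≤ q × q ≤ p)

Between-self⇒≡ : ∀ {p q} → Between p q p → p ≡ q
Between-self⇒≡ (inj₁ (p≤q , q≤p)) = ≤-antisym p≤q q≤p
Between-self⇒≡ (inj₂ (p≤q , q≤p)) = ≤-antisym p≤q q≤p

Between-split : ∀ {p q r} → Between p q r → ∀ s → Between p q s ⊎ Between s q r
Between-split {q = q} (inj₁ (p≤q , q≤r)) s with ≤-total s q
... | inj₁ s≤q = inj₂ (inj₁ (s≤q , q≤r))
... | inj₂ q≤s = inj₁ (inj₁ (p≤q , q≤s))
Between-split {q = q} (inj₂ (r≤q , q≤p)) s with ≤-total s q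
... | inj₁ s≤q = inj₁ (inj₂ (s≤q , q≤p))
... | inj₂ q≤s = inj₂ (inj₂ (r≤q , q≤s))

one-lies-between : ∀ p q r → Between q p r ⊎ Between p q r ⊎ Between p r q
one-lies-between p q r with ≤-total p q | ≤-total q r | ≤-total p r
... | inj₁ p≤q | inj₁ q≤r | _        = inj₂ (inj₁ (inj₁ (p≤q , q≤r)))
... | inj₂ q≤p | inj₂ r≤q | _        = inj₂ (inj₁ (inj₂ (r≤q , q≤p)))
... | inj₁ p≤q | inj₂ r≤q | inj₁ p≤r = inj₂ (inj₂ (inj₁ (p≤r , r≤q)))
... | inj₁ p≤q | inj₂ r≤q | inj₂ r≤p = inj₁ (inj₂ (r≤p , p≤q))
... | inj₂ q≤p | inj₁ q≤r | inj₁ p≤r = inj₁ (inj₁ (q≤p , p≤r))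
... | inj₂ q≤p | inj₁ q≤r | inj₂ r≤p = inj₂ (inj₂ (inj₂ (q≤r , r≤p)))

pt∈I : (a : IntervalPoint) → pt a ∈I a
pt∈I a = lo≤pt a , pt≤hi a

equal-pts⇒BothPointsInBoth : ∀ {a b} → pt a ≡ pt b → BothPointsInBoth a b
equal-pts⇒BothPointsInBoth {a} {b} pa≡pb =
  pt∈I a , subst (_∈I b) (≡.sym pa≡pb) (pt∈I b) , subst (_∈I a) pa≡pb (pt∈I a) , pt∈I b

pt-between⇒⊂I : ∀ {a b c} → BothPointsInBoth a b →
                ¬ BothPointsInBoth a c → ¬ BothPointsInBoth b c →
                pt a ≤ pt c → pt c ≤ pt b → c ⊂I a
pt-between⇒⊂I {a} {b} {c} (_ , (lo-b≤pa , _) , (_ , pb≤hi-a) , _) ¬ac ¬bc pa≤pc pc≤pb =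
  (<⇒≤ lo-a<lo-c , ≤-trans (<⇒≤ hi-c<pb) pb≤hi-a) ,
  λ (lo-c≡lo-a , _) → <⇒≢ lo-a<lo-c (≡.sym lo-c≡lo-a)
  where
  pc∈a : pt c ∈I a
  pc∈a = ≤-trans (lo≤pt a) pa≤pc , ≤-trans pc≤pb pb≤hi-a
  pc∈b : pt c ∈I b
  pc∈b = ≤-trans lo-b≤pa pa≤pc , ≤-trans pc≤pb (pt≤hi b)
  pa<lo-c : pt a < lo c
  pa<lo-c = ≰⇒> λ lo-c≤pa → ¬ac (pt∈I a , (lo-c≤pa , ≤-trans pa≤pc (pt≤hi c)) , pc∈a , pt∈I c)
  hi-c<pb : hi c < pt b
  hi-c<pb = ≰⇒> λ pb≤hi-c → ¬bc (pt∈I b , (≤-trans (lo≤pt c) pc≤pb , pb≤hi-c) , pc∈b , pt∈I c)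
  lo-a<lo-c : lo a < lo c
  lo-a<lo-c = ≤-<-trans (lo≤pt a) pa<lo-c

PathAvoiding-start : ∀ {G z x y} → PathAvoiding G z x y → OutsideN[ G ] z x
PathAvoiding-start (here x∉N[z])     = x∉N[z]
PathAvoiding-start (step x∉N[z] _ _) = x∉N[z]

module ProperMPTRepresentation (G : Graph) (r : Fin (n G) → IntervalPoint)
                               (rep : IsMPTRep G r) (proper : IsProperRep G r) where

  P : Fin (n G) → ℚ
  P u = pt (r u)

  Adj⇒BothPointsInBoth : ∀ {x y} → Adj G x y → BothPointsInBoth (r x) (r y)
  Adj⇒BothPointsInBoth {x} {y} xy =
    Equivalence.to (rep x y λ { x≡y → irrefl G (subst (Adj G x) (≡.sym x≡y) xy) }) xy

  outside⇒¬BothPointsInBoth : ∀ {z x} → OutsideN[ G ] z x → ¬ BothPointsInBoth (r x) (r z)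
  outside⇒¬BothPointsInBoth {z} {x} (x≢z , ¬xz) both = ¬xz (Equivalence.from (rep x z x≢z) both)

  no-edge-across : ∀ {z x y} → OutsideN[ G ] z x → OutsideN[ G ] z y → Adj G x y →
                   ¬ Between (P x) (P z) (P y)
  no-edge-across {z} {x} {y} x∉N[z] y∉N[z] xy (inj₁ (px≤pz , pz≤py)) =
    proper z x (pt-between⇒⊂I {r x} {r y} {r z} (Adj⇒BothPointsInBoth xy)
                  (outside⇒¬BothPointsInBoth x∉N[z]) (outside⇒¬BothPointsInBoth y∉N[z])
                  px≤pz pz≤py)
  no-edge-across x∉N[z] y∉N[z] xy (inj₂ (py≤pz , pz≤px)) =
    no-edge-across y∉N[z] x∉N[z] (Graph.sym G xy) (inj₁ (py≤pz , pz≤px))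

  no-avoiding-path-across : ∀ {z x y} → PathAvoiding G z x y → ¬ Between (P x) (P z) (P y)
  no-avoiding-path-across {z} {x} (here x∉N[z]) xzx =
    outside⇒¬BothPointsInBoth x∉N[z]
      (equal-pts⇒BothPointsInBoth {r x} {r z} (Between-self⇒≡ xzx))
  no-avoiding-path-across (step {w = w} x∉N[z] xw path) xzy
    with Between-split xzy (P w)
  ... | inj₁ xzw = no-edge-across x∉N[z] (PathAvoiding-start path) xw xzw
  ... | inj₂ wzy = no-avoiding-path-across path wzy

lemma3p6 : (G : Graph) → IsProperMPTG G → IsATFree G
lemma3p6 G (r , rep , proper) a b c
         (_ , _ , _ , _ , _ , _ , ab-avoiding-c , bc-avoiding-a , ac-avoiding-b) =
  [ no-avoiding-path-across bc-avoiding-a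
  , [ no-avoiding-path-across ac-avoiding-b , no-avoiding-path-across ab-avoiding-c ]′
  ]′ (one-lies-between (P a) (P b) (P c))
  where open ProperMPTRepresentation G r rep proper
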